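{- Confluent, simple two-stack machine uniform boundedness many-one reduces to simple semi-unification; that is, there is a computable function mapping each confluent, simple two-stack machine $S$ to a finite set $\mathcal{C}$ of simple constraints such that $S$ is uniformly bounded if and only if there exist substitutions $\varphi,\psi_0,\psi_1$ with $(\varphi,\psi_0,\psi_1)\models c$ for every $c\in\mathcal{C}$.
   Context: Two-stack machines: fix a countably infinite set $\mathbb{S}$ of states. A two-stack machine $S$ is a finite list of instructions $\langle A,p,B\rangle\to\langle A',q,B'\rangle$ with $A,B,A',B'\in\{0,1\}^*$, $p,q\in\mathbb{S}$. Configurations are $\langle A,p,B\rangle$ with $A,B\in\{0,1\}^*$, $p\in\mathbb{S}$. Step: if $(\langle A,p,B\rangle\to\langle A',q,B'\rangle)\in S$, then for all $C,D\in\{0,1\}^*$, $\langle CA,p,BD\rangle\longrightarrow_S\langle CA',q,B'D\rangle$; $\longrightarrow_S^*$ is the reflexive transitive closure. $S$ is uniformly bounded if there is $n$ such that from every configuration at most $n$ distinct configurations are reachable. $S$ is simple if each instruction satisfies $1=|A|+|B|=|A'|+|B'|=|A|+|A'|=|B|+|B'|$. $S$ is confluent if $X\longrightarrow_S^*Y_1$ and $X\longrightarrow_S^*Y_2$ imply existence of $Z$ with $Y_1\longrightarrow_S^*Z$, $Y_2\longrightarrow_S^*Z$. Terms: given a countably infinite set $\mathbb{V}$ of variables, terms are given by $\sigma,\tau::=\alpha\mid\sigma\to\tau$ with $\alpha\in\mathbb{V}$. A substitution is a map $\mathbb{V}\to$ terms, lifted homomorphically to terms. A simple constraint has shape $\langle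 a,\alpha,\epsilon\rangle\doteq\langle\epsilon,\beta,b\rangle$ with $a,b\in\{0,1\}$ and $\alpha,\beta\in\mathbb{V}$. A triple of substitutions $(\varphi,\psi_0,\psi_1)$ models it, written $(\varphi,\psi_0,\psi_1)\models\langle a,\alpha,\epsilon\rangle\doteq\langle\epsilon,\beta,b\rangle$, if either $b=0$ and $\psi_a(\varphi(\alpha))\to\tau=\varphi(\beta)$ for some term $\tau$, or $b=1$ and $\sigma\to\psi_a(\varphi(\alpha))=\varphi(\beta)$ for some term $\sigma$. Simple semi-unification asks, for a finite set of simple constraints, whether some triple models all of them. Many-one reduction: a computable $f$ with $P(x)\iff Q(f(x))$ for all inputs $x$. -}

module Defs where

open import Data.Nat using (ℕ; _+_; _≤_)
open import Data.Bool using (Bool; true; false)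
open import Data.List using (List; _++_; length)
open import Data.List.Membership.Propositional using (_∈_)
open import Data.List.Relation.Unary.All using (All)
open import Data.List.Relation.Unary.Unique.Propositional using (Unique)
open import Data.Product using (Σ; ∃; _×_; _,_)
open import Relation.Binary.PropositionalEquality using (_≡_)
open import Relation.Binary.Construct.Closure.ReflexiveTransitive using (Star)

-- Bits 0,1 are represented by false,true; words in {0,1}* by List Bool.
Word : Set
Word = List Bool

State : Set
State = ℕ

record Config : Set where
  constructor ⟨_,_,_⟩
  field
    left  : Word
    state : State
    right : Word

record Instr : Set where
  constructor _⟶_
  field
    lhs : Config
    rhs : Config

Machine : Set
Machine = List Instr

data Step (S : Machine) : Config → Config → Set where
  step : ∀ {A p B A' q B'} →
         (⟨ A , p , B ⟩ ⟶ ⟨ A' , q , B' ⟩) ∈ S →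
         (C D : Word) →
         Step S ⟨ C ++ A , p , B ++ D ⟩ ⟨ C ++ A' , q , B' ++ D ⟩

Steps : Machine → Config → Config → Set
Steps S = Star (Step S)

UniformlyBounded : Machine → Set
UniformlyBounded S =
  Σ ℕ λ n → (X : Config) (L : List Config) →
    Unique L → All (Steps S X) L → length L ≤ n

SimpleInstr : Instr → Set
SimpleInstr (⟨ A , p , B ⟩ ⟶ ⟨ A' , q , B' ⟩) =
  (1 ≡ length A + length B) × (1 ≡ length A' + length B') ×
  (1 ≡ length A + length A') × (1 ≡ length B + length B')

Simple : Machine → Set
Simple S = All SimpleInstr S

Confluent : Machine → Set
Confluent S = (X Y₁ Y₂ : Config) → Steps S X Y₁ → Steps S X Y₂ →
  Σ Config λ Z → Steps S Y₁ Z × Steps S Y₂ Z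

Var : Set
Var = ℕ

infixr 5 _⇒_
data Term : Set where
  var : Var → Term
  _⇒_ : Term → Term → Term

Subst : Set
Subst = Var → Term

applySubst : Subst → Term → Term
applySubst φ (var α)   = φ α
applySubst φ (σ ⇒ τ) = applySubst φ σ ⇒ applySubst φ τ

record Constraint : Set where
  constructor ⟨_,_,ε⟩≐⟨ε,_,_⟩
  field
    a : Bool
    α : Var
    β : Var
    b : Bool

selectψ : Subst → Subst → Bool → Subst
selectψ ψ₀ ψ₁ false = ψ₀
selectψ ψ₀ ψ₁ true  = ψ₁

Models : Subst → Subst → Subst → Constraint → Set
Models φ ψ₀ ψ₁ ⟨ a , α ,ε⟩≐⟨ε, β , false ⟩ =
  Σ Term λ τ → (applySubst (selectψ ψ₀ ψ₁ a) (φ α) ⇒ τ) ≡ φ β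
Models φ ψ₀ ψ₁ ⟨ a , α ,ε⟩≐⟨ε, β , true ⟩ =
  Σ Term λ σ → (σ ⇒ applySubst (selectψ ψ₀ ψ₁ a) (φ α)) ≡ φ β

SSUSolvable : List Constraint → Set
SSUSolvable C = Σ Subst λ φ → Σ Subst λ ψ₀ → Σ Subst λ ψ₁ → All (Models φ ψ₀ ψ₁) C

-- Each simple instruction is a move ⟨a,p,ε⟩ → ⟨ε,q,b⟩ or the reverse of one, and is sent
-- to the constraint ⟨a,p,ε⟩ ≐ ⟨ε,q,b⟩.
--
-- Given a solution (φ, ψ₀, ψ₁), let ⟨E,p,F⟩ denote the subterm at path F of ψ_E(φ p); steps
-- preserve this denotation. A run from X only touches a core of X from which both stacks can
-- be emptied. Emptying the right stack shows that the denotation is defined, so the core is no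
-- larger than the depth of some φ q, and the reachable configurations are among boundedly many
-- reframings of X.
--
-- Conversely, if at most n configurations are reachable from any configuration of a confluent
-- machine, joinability ≈ is a decidable equivalence, preserved by extending either stack, whose
-- classes vary by at most 2n in the length of each stack. Let φ p unfold ⟨ε,p,ε⟩ along the right
-- stack: the tree branches at configurations joinable with some ⟨E,q,ε⟩ and is elsewhere a
-- variable naming the ≈-class; ψ_a sends the variable of ⟨ε,p,G⟩ to the tree of ⟨a,p,G⟩. Then
-- ψ_a(φ p) is the tree of ⟨a,p,ε⟩, which a move ⟨a,p,ε⟩ → ⟨ε,q,b⟩ identifies with the
-- b-branch of φ q.

module Submission where

open import Defs
open import Data.Bool using (Bool; true; false)
import Data.Bool.Properties as Bool
open import Data.Empty using (⊥-elim)
open import Data.List using (List; []; _∷_; _++_; _∷ʳ_; [_]; length; map; concatMap; upTo; take; drop; head;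
  cartesianProduct; initLast; _∷ʳ′_)
open import Data.List.Properties
  using (++-assoc; ++-identityʳ; length-++; length-map; length-++-sucʳ; ∷ʳ-injective; ≡-dec)
open import Data.List.Membership.Propositional using (_∈_; find; lose)
open import Data.List.Membership.Propositional.Properties
  using (∈-++⁺ˡ; ∈-++⁺ʳ; ∈-++⁻; ∈-∃++; ∈-map⁺; ∈-map⁻; ∈-concatMap⁺; ∈-concatMap⁻;
         ∈-cartesianProduct⁺; ∈-cartesianProduct⁻; ∈-upTo⁺)
open import Data.List.Relation.Binary.Subset.Propositional using (_⊆_)
open import Data.List.Relation.Unary.Any as Any using (Any; here; there)
open import Data.List.Relation.Unary.All as All using (All; []; _∷_)
open import Data.List.Relation.Unary.AllPairs using ([]; _∷_)
open import Data.List.Relation.Unary.All.Properties using (¬Any⇒All¬; map⁺)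
open import Data.List.Relation.Unary.Unique.Propositional using (Unique)
import Data.List.Relation.Unary.Unique.Propositional.Properties as Unique
open import Data.Nat using (ℕ; zero; suc; _+_; _≤_; _∸_; _⊔_; ∣_-_∣; z≤n; s≤s)
import Data.Nat.Properties as ℕ
open import Data.List.Extrema.Nat using (max; xs≤max)
open import Data.Maybe using (Maybe; just; nothing; maybe′)
open import Data.Product using (Σ; ∃; ∃₂; _×_; _,_; proj₁; proj₂; uncurry)
open import Data.Sum using (_⊎_; inj₁; inj₂)
open import Function using (_∘_)
open import Relation.Binary.Construct.Closure.ReflexiveTransitive using (Star; ε; _◅_; _◅◅_; gmap)
open import Relation.Binary.Definitions using (DecidableEquality)
open import Relation.Nullary using (Dec; yes; no; ¬_)
open import Relation.Binary.PropositionalEquality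
  using (_≡_; refl; sym; trans; cong; cong₂; subst; subst₂; module ≡-Reasoning)

initLast-∷ʳ : ∀ {A : Set} (xs : List A) x → initLast (xs ∷ʳ x) ≡ xs ∷ʳ′ x
initLast-∷ʳ [] x = refl
initLast-∷ʳ (y ∷ xs) x rewrite initLast-∷ʳ xs x = refl

length-∷ʳ : ∀ {A : Set} (xs : List A) x → length (xs ∷ʳ x) ≡ suc (length xs)
length-∷ʳ []       x = refl
length-∷ʳ (y ∷ xs) x = cong suc (length-∷ʳ xs x)

∷ʳ≡++⇒ : ∀ {A : Set} (C : List A) a C₀ E → C ∷ʳ a ≡ C₀ ++ E →
         (E ≡ [] × C₀ ≡ C ∷ʳ a) ⊎ ∃ λ E′ → E ≡ E′ ∷ʳ a × C ≡ C₀ ++ E′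
∷ʳ≡++⇒ C a C₀ E eq with initLast E
... | [] = inj₁ (refl , trans (sym (++-identityʳ C₀)) (sym eq))
... | E′ ∷ʳ′ a′ with ∷ʳ-injective C (C₀ ++ E′) (trans eq (sym (++-assoc C₀ E′ [ a′ ])))
...   | refl , refl = inj₂ (E′ , refl , refl)

take-length-++ : ∀ {A : Set} (xs ys : List A) → take (length xs) (xs ++ ys) ≡ xs
take-length-++ []       ys = refl
take-length-++ (x ∷ xs) ys = cong (x ∷_) (take-length-++ xs ys)

drop-length-++ : ∀ {A : Set} (xs ys : List A) → drop (length xs) (xs ++ ys) ≡ ys
drop-length-++ []       ys = refl
drop-length-++ (x ∷ xs) ys = drop-length-++ xs ys

unique⇒length≤ : ∀ {A : Set} {xs ys : List A} → Unique xs → xs ⊆ ys → length xs ≤ length ys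
unique⇒length≤ {xs = []}     _            _    = z≤n
unique⇒length≤ {xs = x ∷ xs} (x∉xs ∷ !xs) x∷xs⊆ys with ∈-∃++ (x∷xs⊆ys (here refl))
... | ys₁ , ys₂ , refl =
  ℕ.≤-trans (s≤s (unique⇒length≤ !xs xs⊆)) (ℕ.≤-reflexive (sym (length-++-sucʳ ys₁ x ys₂)))
  where
  xs⊆ : xs ⊆ ys₁ ++ ys₂
  xs⊆ y∈xs with ∈-++⁻ ys₁ (x∷xs⊆ys (there y∈xs))
  ... | inj₁ y∈ys₁         = ∈-++⁺ˡ y∈ys₁
  ... | inj₂ (here refl)   = ⊥-elim (All.lookup x∉xs y∈xs refl)
  ... | inj₂ (there y∈ys₂) = ∈-++⁺ʳ ys₁ y∈ys₂

wordsUpTo : ℕ → List Word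
wordsUpTo zero    = [ [] ]
wordsUpTo (suc k) = [] ∷ map (false ∷_) (wordsUpTo k) ++ map (true ∷_) (wordsUpTo k)

∈-wordsUpTo : ∀ {k} w → length w ≤ k → w ∈ wordsUpTo k
∈-wordsUpTo {zero}  []          _         = here refl
∈-wordsUpTo {suc k} []          _         = here refl
∈-wordsUpTo {suc k} (false ∷ w) (s≤s |w|≤k) = there (∈-++⁺ˡ (∈-map⁺ (false ∷_) (∈-wordsUpTo w |w|≤k)))
∈-wordsUpTo {suc k} (true ∷ w)  (s≤s |w|≤k) =
  there (∈-++⁺ʳ (map (false ∷_) (wordsUpTo k)) (∈-map⁺ (true ∷_) (∈-wordsUpTo w |w|≤k)))

module _ {A : Set} {R : A → A → Set} where

  steps : ∀ {x y} → Star R x y → ℕ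
  steps ε       = 0
  steps (_ ◅ r) = suc (steps r)

  ∣-∣-along : (g : A → ℕ) → (∀ {x y} → R x y → ∣ g x - g y ∣ ≡ 1) →
              ∀ {x y} (r : Star R x y) → ∣ g x - g y ∣ ≤ steps r
  ∣-∣-along g unit ε = ℕ.≤-reflexive (ℕ.∣n-n∣≡0 (g _))
  ∣-∣-along g unit {x} {y} (_◅_ {j = z} s r) =
    ℕ.≤-trans (ℕ.∣-∣-triangle (g x) (g z) (g y)) (ℕ.+-mono-≤ (ℕ.≤-reflexive (unit s)) (∣-∣-along g unit r))

  trace : ∀ {x y} → Star R x y → List A
  trace {x} ε       = [ x ]
  trace {x} (_ ◅ r) = x ∷ trace r

  length-trace : ∀ {x y} (r : Star R x y) → length (trace r) ≡ suc (steps r)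
  length-trace ε       = refl
  length-trace (_ ◅ r) = cong suc (length-trace r)

  trace-reachable : ∀ {x y} (r : Star R x y) → All (Star R x) (trace r)
  trace-reachable ε       = ε ∷ []
  trace-reachable (s ◅ r) = ε ∷ All.map (s ◅_) (trace-reachable r)

  module _ (_≟_ : DecidableEquality A) where

    private
      suffixFrom : ∀ {x z y} (r : Star R z y) → x ∈ trace r →
                   ∃₂ λ (r′ : Star R x y) pre → trace r ≡ pre ++ trace r′
      suffixFrom ε        (here refl) = ε , [] , refl
      suffixFrom (s ◅ r)  (here refl) = s ◅ r , [] , refl
      suffixFrom {z = z} (_ ◅ r) (there x∈) with suffixFrom r x∈
      ... | r′ , pre , eq = r′ , z ∷ pre , cong (z ∷_) eq

    eraseLoops : ∀ {x y} (r : Star R x y) → ∃ λ (r′ : Star R x y) → Unique (trace r′)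
    eraseLoops ε = ε , [] ∷ []
    eraseLoops {x} (s ◅ r) with eraseLoops r
    ... | r′ , !r′ with Any.any? (x ≟_) (trace r′)
    ...   | no  x∉r′ = s ◅ r′ , ¬Any⇒All¬ (trace r′) x∉r′ ∷ !r′
    ...   | yes x∈r′ with suffixFrom r′ x∈r′
    ...     | r″ , pre , eq =
      r″ , subst Unique (drop-length-++ pre (trace r″)) (Unique.drop⁺ (length pre) (subst Unique eq !r′))

depth : Term → ℕ
depth (var _) = 0
depth (l ⇒ r) = suc (depth l ⊔ depth r)

branch : Bool → Term → Term → Term
branch false l r = l
branch true  l r = r

branch-map : ∀ (f : Term → Term) b l r → branch b (f l) (f r) ≡ f (branch b l r)
branch-map f false l r = refl
branch-map f true  l r = refl

-- On paths, false selects the domain and true the codomain of an arrow.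
_at_ : Term → Word → Maybe Term
t       at []      = just t
var _   at (_ ∷ _) = nothing
(l ⇒ r) at (b ∷ F) = branch b l r at F

at-depth : ∀ t F {u} → t at F ≡ just u → length F ≤ depth t
at-depth t       []          _  = z≤n
at-depth (l ⇒ r) (false ∷ F) eq = s≤s (ℕ.≤-trans (at-depth l F eq) (ℕ.m≤m⊔n (depth l) (depth r)))
at-depth (l ⇒ r) (true  ∷ F) eq = s≤s (ℕ.≤-trans (at-depth r F eq) (ℕ.m≤n⊔m (depth l) (depth r)))

data Move : Set where
  shiftʳ shiftˡ : Bool → State → State → Bool → Move

instr : Move → Instr
instr (shiftʳ a p q b) = ⟨ [ a ] , p , [] ⟩ ⟶ ⟨ [] , q , [ b ] ⟩
instr (shiftˡ a p q b) = ⟨ [] , p , [ b ] ⟩ ⟶ ⟨ [ a ] , q , [] ⟩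

movesOf : Instr → List Move
movesOf (⟨ a ∷ [] , p , [] ⟩ ⟶ ⟨ [] , q , b ∷ [] ⟩) = [ shiftʳ a p q b ]
movesOf (⟨ [] , p , b ∷ [] ⟩ ⟶ ⟨ a ∷ [] , q , [] ⟩) = [ shiftˡ a p q b ]
movesOf _ = []

moves : Machine → List Move
moves = concatMap movesOf

∈-moves⁺ : ∀ {S} m → instr m ∈ S → m ∈ moves S
∈-moves⁺ m i∈S = ∈-concatMap⁺ movesOf (Any.map (λ { refl → m∈movesOf m }) i∈S)
  where
  m∈movesOf : ∀ m → m ∈ movesOf (instr m)
  m∈movesOf (shiftʳ a p q b) = here refl
  m∈movesOf (shiftˡ a p q b) = here refl

∈-moves⁻ : ∀ {S m} → m ∈ moves S → instr m ∈ S
∈-moves⁻ {S} m∈ = Any.map (λ {i} → movesOf-sound i) (∈-concatMap⁻ movesOf {xs = S} m∈)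
  where
  movesOf-sound : ∀ i {m} → m ∈ movesOf i → instr m ≡ i
  movesOf-sound (⟨ a ∷ [] , p , [] ⟩ ⟶ ⟨ [] , q , b ∷ [] ⟩) (here refl) = refl
  movesOf-sound (⟨ [] , p , b ∷ [] ⟩ ⟶ ⟨ a ∷ [] , q , [] ⟩) (here refl) = refl

simple⇒move : ∀ i → SimpleInstr i → ∃ λ m → instr m ≡ i
simple⇒move (⟨ [] , p , b ∷ [] ⟩ ⟶ ⟨ a ∷ [] , q , [] ⟩) _ = shiftˡ a p q b , refl
simple⇒move (⟨ a ∷ [] , p , [] ⟩ ⟶ ⟨ [] , q , b ∷ [] ⟩) _ = shiftʳ a p q b , refl
simple⇒move (⟨ [] , _ , [] ⟩ ⟶ _) (() , _)
simple⇒move (⟨ [] , _ , _ ∷ _ ∷ _ ⟩ ⟶ _) (() , _)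
simple⇒move (⟨ _ ∷ _ ∷ _ , _ , _ ⟩ ⟶ _) (() , _)
simple⇒move (⟨ _ ∷ [] , _ , _ ∷ _ ⟩ ⟶ _) (() , _)
simple⇒move (⟨ [] , _ , _ ∷ [] ⟩ ⟶ ⟨ [] , _ , _ ⟩) (_ , _ , () , _)
simple⇒move (⟨ [] , _ , _ ∷ [] ⟩ ⟶ ⟨ _ ∷ _ ∷ _ , _ , _ ⟩) (_ , _ , () , _)
simple⇒move (⟨ [] , _ , _ ∷ [] ⟩ ⟶ ⟨ _ ∷ [] , _ , _ ∷ _ ⟩) (_ , () , _)
simple⇒move (⟨ _ ∷ [] , _ , [] ⟩ ⟶ ⟨ _ ∷ _ , _ , _ ⟩) (_ , _ , () , _)
simple⇒move (⟨ _ ∷ [] , _ , [] ⟩ ⟶ ⟨ [] , _ , [] ⟩) (_ , () , _)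
simple⇒move (⟨ _ ∷ [] , _ , [] ⟩ ⟶ ⟨ [] , _ , _ ∷ _ ∷ _ ⟩) (_ , () , _)

-- The constraint of a move depends only on the two configurations it connects, not on its direction.
constraint : Move → Constraint
constraint (shiftʳ a p q b) = ⟨ a , p ,ε⟩≐⟨ε, q , b ⟩
constraint (shiftˡ a p q b) = ⟨ a , q ,ε⟩≐⟨ε, p , b ⟩

reduction : Machine → List Constraint
reduction S = map constraint (moves S)

data Fires : Move → Config → Config → Set where
  fireʳ : ∀ {a p q b} C D → Fires (shiftʳ a p q b) ⟨ C ∷ʳ a , p , D ⟩ ⟨ C , q , b ∷ D ⟩
  fireˡ : ∀ {a p q b} C D → Fires (shiftˡ a p q b) ⟨ C , p , b ∷ D ⟩ ⟨ C ∷ʳ a , q , D ⟩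

step⇒fires : ∀ {S X Y} → Simple S → Step S X Y → ∃ λ m → m ∈ moves S × Fires m X Y
step⇒fires simple (step {A} {p₀} {B} {A′} {q₀} {B′} i∈S C D)
  with simple⇒move (⟨ A , p₀ , B ⟩ ⟶ ⟨ A′ , q₀ , B′ ⟩) (All.lookup simple i∈S)
... | m@(shiftʳ a p q b) , refl =
  m , ∈-moves⁺ m i∈S ,
  subst (λ C′ → Fires m ⟨ C ∷ʳ a , p , D ⟩ ⟨ C′ , q , b ∷ D ⟩) (sym (++-identityʳ C)) (fireʳ C D)
... | m@(shiftˡ a p q b) , refl =
  m , ∈-moves⁺ m i∈S ,
  subst (λ C′ → Fires m ⟨ C′ , p , b ∷ D ⟩ ⟨ C ∷ʳ a , q , D ⟩) (sym (++-identityʳ C)) (fireˡ C D)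

fires⇒step : ∀ {S m X Y} → m ∈ moves S → Fires m X Y → Step S X Y
fires⇒step {S} m∈ (fireʳ {a} {p} {q} {b} C D) =
  subst (λ C′ → Step S ⟨ C ∷ʳ a , p , D ⟩ ⟨ C′ , q , b ∷ D ⟩) (++-identityʳ C) (step (∈-moves⁻ m∈) C D)
fires⇒step {S} m∈ (fireˡ {a} {p} {q} {b} C D) =
  subst (λ C′ → Step S ⟨ C′ , p , b ∷ D ⟩ ⟨ C ∷ʳ a , q , D ⟩) (++-identityʳ C) (step (∈-moves⁻ m∈) C D)

fire : Move → Config → List Config
fire (shiftʳ a p q b) ⟨ L , r , R ⟩ with initLast L
... | [] = []
... | C ∷ʳ′ c with r ℕ.≟ p | c Bool.≟ a
...   | yes refl | yes refl = [ ⟨ C , q , b ∷ R ⟩ ]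
...   | _        | _        = []
fire (shiftˡ a p q b) ⟨ L , r , [] ⟩ = []
fire (shiftˡ a p q b) ⟨ L , r , c ∷ R ⟩ with r ℕ.≟ p | c Bool.≟ b
... | yes refl | yes refl = [ ⟨ L ∷ʳ a , q , R ⟩ ]
... | _        | _        = []

fire-sound : ∀ m X {Y} → Y ∈ fire m X → Fires m X Y
fire-sound (shiftʳ a p q b) ⟨ L , r , R ⟩ Y∈ with initLast L
... | C ∷ʳ′ c with r ℕ.≟ p | c Bool.≟ a
fire-sound (shiftʳ a p q b) ⟨ _ , r , R ⟩ (here refl) | C ∷ʳ′ c | yes refl | yes refl = fireʳ C R
fire-sound (shiftˡ a p q b) ⟨ L , r , c ∷ R ⟩ Y∈ with r ℕ.≟ p | c Bool.≟ b
fire-sound (shiftˡ a p q b) ⟨ L , r , c ∷ R ⟩ (here refl) | yes refl | yes refl = fireˡ L R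

fire-complete : ∀ {m X Y} → Fires m X Y → Y ∈ fire m X
fire-complete (fireʳ {a} {p} C D) rewrite initLast-∷ʳ C a with p ℕ.≟ p | a Bool.≟ a
... | yes refl | yes refl = here refl
... | no p≢p   | _        = ⊥-elim (p≢p refl)
... | yes _    | no a≢a   = ⊥-elim (a≢a refl)
fire-complete (fireˡ {a} {p} {q} {b} C D) with p ℕ.≟ p | b Bool.≟ b
... | yes refl | yes refl = here refl
... | no p≢p   | _        = ⊥-elim (p≢p refl)
... | yes _    | no b≢b   = ⊥-elim (b≢b refl)

_≟ᶜ_ : DecidableEquality Config
⟨ E , p , F ⟩ ≟ᶜ ⟨ E′ , p′ , F′ ⟩ with ≡-dec Bool._≟_ E E′ | p ℕ.≟ p′ | ≡-dec Bool._≟_ F F′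
... | yes refl | yes refl | yes refl = yes refl
... | no E≢E′  | _        | _        = no λ { refl → E≢E′ refl }
... | yes _    | no p≢p′  | _        = no λ { refl → p≢p′ refl }
... | yes _    | yes _    | no F≢F′  = no λ { refl → F≢F′ refl }

extendˡ : Word → Config → Config
extendˡ C ⟨ E , p , F ⟩ = ⟨ C ++ E , p , F ⟩

extendʳ : Word → Config → Config
extendʳ D ⟨ E , p , F ⟩ = ⟨ E , p , F ++ D ⟩

module _ {S : Machine} where

  step-extendˡ : ∀ {X Y} C₀ → Step S X Y → Step S (extendˡ C₀ X) (extendˡ C₀ Y)
  step-extendˡ C₀ (step {A} {p} {B} {A′} {q} {B′} i∈S C D) =
    subst₂ (Step S) (cong (λ E → ⟨ E , p , B ++ D ⟩) (++-assoc C₀ C A))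
                    (cong (λ E → ⟨ E , q , B′ ++ D ⟩) (++-assoc C₀ C A′))
                    (step i∈S (C₀ ++ C) D)

  step-extendʳ : ∀ {X Y} D₀ → Step S X Y → Step S (extendʳ D₀ X) (extendʳ D₀ Y)
  step-extendʳ D₀ (step {A} {p} {B} {A′} {q} {B′} i∈S C D) =
    subst₂ (Step S) (cong (λ F → ⟨ C ++ A , p , F ⟩) (sym (++-assoc B D D₀)))
                    (cong (λ F → ⟨ C ++ A′ , q , F ⟩) (sym (++-assoc B′ D D₀)))
                    (step i∈S C (D ++ D₀))

  steps-extendˡ : ∀ {X Y} C₀ → Steps S X Y → Steps S (extendˡ C₀ X) (extendˡ C₀ Y)
  steps-extendˡ C₀ = gmap (extendˡ C₀) (step-extendˡ C₀)

  steps-extendʳ : ∀ {X Y} D₀ → Steps S X Y → Steps S (extendʳ D₀ X) (extendʳ D₀ Y)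
  steps-extendʳ D₀ = gmap (extendʳ D₀) (step-extendʳ D₀)

frame : Word → Word → Config → Config
frame C D = extendˡ C ∘ extendʳ D

frame-inwardʳ : ∀ C b D Y → frame C (b ∷ D) Y ≡ frame C D (extendʳ [ b ] Y)
frame-inwardʳ C b D ⟨ E , p , F ⟩ = cong (λ F′ → ⟨ C ++ E , p , F′ ⟩) (sym (++-assoc F [ b ] D))

frame-inwardˡ : ∀ C a D Y → frame (C ∷ʳ a) D Y ≡ frame C D (extendˡ [ a ] Y)
frame-inwardˡ C a D ⟨ E , p , F ⟩ = cong (λ E′ → ⟨ E′ , p , F ++ D ⟩) (++-assoc C [ a ] E)

reframe : Config → ℕ × ℕ × State × Word × Word → Config
reframe ⟨ L , _ , R ⟩ (i , j , q , E′ , F′) = ⟨ take (length L ∸ i) L ++ E′ , q , F′ ++ drop j R ⟩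

reframe-frame : ∀ C₀ D₀ E p F E′ q F′ →
  reframe (frame C₀ D₀ ⟨ E , p , F ⟩) (length E , length F , q , E′ , F′) ≡ frame C₀ D₀ ⟨ E′ , q , F′ ⟩
reframe-frame C₀ D₀ E p F E′ q F′ =
  cong₂ (λ C D → ⟨ C ++ E′ , q , F′ ++ D ⟩) outer-left (drop-length-++ F D₀)
  where
  outer-left : take (length (C₀ ++ E) ∸ length E) (C₀ ++ E) ≡ C₀
  outer-left = trans (cong (λ k → take k (C₀ ++ E))
                           (trans (cong (_∸ length E) (length-++ C₀)) (ℕ.m+n∸n≡m (length C₀) (length E))))
                     (take-length-++ C₀ E)

lenˡ lenʳ size : Config → ℕ
lenˡ X = length (Config.left X)
lenʳ X = length (Config.right X)
size X = lenˡ X + lenʳ X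

fires-size : ∀ {m X Y} → Fires m X Y → size X ≡ size Y
fires-size (fireʳ C D) = trans (cong (_+ length D) (length-∷ʳ C _)) (sym (ℕ.+-suc (length C) (length D)))
fires-size (fireˡ C D) = trans (ℕ.+-suc (length C) (length D)) (cong (_+ length D) (sym (length-∷ʳ C _)))

∣n-1+n∣≡1 : ∀ n → ∣ n - suc n ∣ ≡ 1
∣n-1+n∣≡1 zero    = refl
∣n-1+n∣≡1 (suc n) = ∣n-1+n∣≡1 n

∣1+n-n∣≡1 : ∀ n → ∣ suc n - n ∣ ≡ 1
∣1+n-n∣≡1 n = trans (ℕ.∣-∣-comm (suc n) n) (∣n-1+n∣≡1 n)

fires-lenˡ : ∀ {m X Y} → Fires m X Y → ∣ lenˡ X - lenˡ Y ∣ ≡ 1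
fires-lenˡ (fireʳ C D) = trans (cong ∣_- length C ∣ (length-∷ʳ C _)) (∣1+n-n∣≡1 (length C))
fires-lenˡ (fireˡ C D) = trans (cong ∣ length C -_∣ (length-∷ʳ C _)) (∣n-1+n∣≡1 (length C))

fires-lenʳ : ∀ {m X Y} → Fires m X Y → ∣ lenʳ X - lenʳ Y ∣ ≡ 1
fires-lenʳ (fireʳ C D) = ∣n-1+n∣≡1 (length D)
fires-lenʳ (fireˡ C D) = ∣1+n-n∣≡1 (length D)

states : Machine → List State
states = concatMap λ { (⟨ _ , p , _ ⟩ ⟶ ⟨ _ , q , _ ⟩) → p ∷ q ∷ [] }

step-states : ∀ {S X Y} → Step S X Y → Config.state X ∈ states S × Config.state Y ∈ states S
step-states (step i∈S C D) =
  ∈-concatMap⁺ _ (Any.map (λ { refl → here refl }) i∈S) ,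
  ∈-concatMap⁺ _ (Any.map (λ { refl → there (here refl) }) i∈S)

run-target : ∀ {S X Y Z} → Step S X Y → Steps S Y Z → Config.state Z ∈ states S
run-target s ε       = proj₂ (step-states s)
run-target _ (s ◅ r) = run-target s r

steps-states : ∀ {S X Y} → Steps S X Y → X ≡ Y ⊎ (Config.state X ∈ states S × Config.state Y ∈ states S)
steps-states ε       = inj₁ refl
steps-states (s ◅ r) = inj₂ (proj₁ (step-states s) , run-target s r)

module _ {S : Machine} (simple : Simple S) where

  step-size : ∀ {X Y} → Step S X Y → size X ≡ size Y
  step-size s = fires-size (proj₂ (proj₂ (step⇒fires simple s)))

  steps-size : ∀ {X Y} → Steps S X Y → size X ≡ size Y
  steps-size ε       = refl
  steps-size (s ◅ r) = trans (step-size s) (steps-size r)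

  ∣lenˡ∣-steps : ∀ {X Y} (r : Steps S X Y) → ∣ lenˡ X - lenˡ Y ∣ ≤ steps r
  ∣lenˡ∣-steps = ∣-∣-along lenˡ (λ s → fires-lenˡ (proj₂ (proj₂ (step⇒fires simple s))))

  ∣lenʳ∣-steps : ∀ {X Y} (r : Steps S X Y) → ∣ lenʳ X - lenʳ Y ∣ ≤ steps r
  ∣lenʳ∣-steps = ∣-∣-along lenʳ (λ s → fires-lenʳ (proj₂ (proj₂ (step⇒fires simple s))))

module Solvable⇒Bounded {S : Machine} (simple : Simple S) {φ ψ₀ ψ₁ : Subst}
  (⊨S : All (Models φ ψ₀ ψ₁) (reduction S)) where

  ψ : Bool → Term → Term
  ψ a = applySubst (selectψ ψ₀ ψ₁ a)

  ψ⋆ : Word → Term → Term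
  ψ⋆ []      t = t
  ψ⋆ (e ∷ E) t = ψ e (ψ⋆ E t)

  ψ⋆-∷ʳ : ∀ C a t → ψ⋆ (C ∷ʳ a) t ≡ ψ⋆ C (ψ a t)
  ψ⋆-∷ʳ []      a t = refl
  ψ⋆-∷ʳ (c ∷ C) a t = cong (ψ c) (ψ⋆-∷ʳ C a t)

  ψ⋆-⇒ : ∀ C l r → ψ⋆ C (l ⇒ r) ≡ ψ⋆ C l ⇒ ψ⋆ C r
  ψ⋆-⇒ []      l r = refl
  ψ⋆-⇒ (c ∷ C) l r = cong (ψ c) (ψ⋆-⇒ C l r)

  ⟦_⟧ : Config → Maybe Term
  ⟦ ⟨ E , p , F ⟩ ⟧ = ψ⋆ E (φ p) at F

  solved-arrow : ∀ {a α β b} → Models φ ψ₀ ψ₁ ⟨ a , α ,ε⟩≐⟨ε, β , b ⟩ →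
                 ∃₂ λ l r → φ β ≡ l ⇒ r × branch b l r ≡ ψ a (φ α)
  solved-arrow {b = false} (τ , eq) = _ , τ , sym eq , refl
  solved-arrow {b = true}  (σ , eq) = σ , _ , sym eq , refl

  ⟦⟧-shift : ∀ {a α β b} → Models φ ψ₀ ψ₁ ⟨ a , α ,ε⟩≐⟨ε, β , b ⟩ →
             ∀ C D → ⟦ ⟨ C ∷ʳ a , α , D ⟩ ⟧ ≡ ⟦ ⟨ C , β , b ∷ D ⟩ ⟧
  ⟦⟧-shift {a} {α} {β} {b} ⊨c C D with solved-arrow ⊨c
  ... | l , r , φβ≡l⇒r , branch≡ = begin
    ψ⋆ (C ∷ʳ a) (φ α) at D           ≡⟨ cong (_at D) (ψ⋆-∷ʳ C a (φ α)) ⟩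
    ψ⋆ C (ψ a (φ α)) at D            ≡⟨ cong (λ t → ψ⋆ C t at D) (sym branch≡) ⟩
    ψ⋆ C (branch b l r) at D         ≡⟨ cong (_at D) (sym (branch-map (ψ⋆ C) b l r)) ⟩
    (ψ⋆ C l ⇒ ψ⋆ C r) at (b ∷ D)     ≡⟨ cong (_at (b ∷ D)) (sym (ψ⋆-⇒ C l r)) ⟩
    ψ⋆ C (l ⇒ r) at (b ∷ D)          ≡⟨ cong (λ t → ψ⋆ C t at (b ∷ D)) (sym φβ≡l⇒r) ⟩
    ψ⋆ C (φ β) at (b ∷ D)            ∎
    where open ≡-Reasoning

  ⟦⟧-fires : ∀ {m X Y} → m ∈ moves S → Fires m X Y → ⟦ X ⟧ ≡ ⟦ Y ⟧
  ⟦⟧-fires m∈ (fireʳ C D) = ⟦⟧-shift (All.lookup ⊨S (∈-map⁺ constraint m∈)) C D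
  ⟦⟧-fires m∈ (fireˡ C D) = sym (⟦⟧-shift (All.lookup ⊨S (∈-map⁺ constraint m∈)) C D)

  ⟦⟧-steps : ∀ {X Y} → Steps S X Y → ⟦ X ⟧ ≡ ⟦ Y ⟧
  ⟦⟧-steps ε = refl
  ⟦⟧-steps (s ◅ r) with step⇒fires simple s
  ... | _ , m∈ , f = trans (⟦⟧-fires m∈ f) (⟦⟧-steps r)

  record Framed (X W : Config) : Set where
    constructor framed
    field
      outerˡ outerʳ : Word
      core core′    : Config
      X≡            : X ≡ frame outerˡ outerʳ core
      W≡            : W ≡ frame outerˡ outerʳ core′
      run           : Steps S core core′
      drainsˡ       : ∃₂ λ q F → Steps S core ⟨ [] , q , F ⟩
      drainsʳ       : ∃₂ λ E q → Steps S core ⟨ E , q , [] ⟩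

  prependʳ : ∀ {a p q b C D W} → shiftʳ a p q b ∈ moves S →
             Framed ⟨ C , q , b ∷ D ⟩ W → Framed ⟨ C ∷ʳ a , p , D ⟩ W
  prependʳ {a} {p} {q} {b} {D = D} m∈ (framed C₀ D₀ ⟨ E , _ , [] ⟩ core′ refl refl run (_ , _ , dl) _) =
    framed C₀ D ⟨ E ∷ʳ a , p , [] ⟩ (extendʳ [ b ] core′)
      (cong (λ E′ → ⟨ E′ , p , D ⟩) (++-assoc C₀ E [ a ]))
      (frame-inwardʳ C₀ b D core′)
      (s ◅ steps-extendʳ [ b ] run) (_ , _ , s ◅ steps-extendʳ [ b ] dl) (_ , _ , ε)
    where s = fires⇒step m∈ (fireʳ E [])
  prependʳ {a} {p} {q} {b} m∈
    (framed C₀ D₀ ⟨ E , _ , .b ∷ F ⟩ core′ refl refl run (_ , _ , dl) (_ , _ , dr)) =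
    framed C₀ D₀ ⟨ E ∷ʳ a , p , F ⟩ core′
      (cong (λ E′ → ⟨ E′ , p , F ++ D₀ ⟩) (++-assoc C₀ E [ a ])) refl
      (s ◅ run) (_ , _ , s ◅ dl) (_ , _ , s ◅ dr)
    where s = fires⇒step m∈ (fireʳ E F)

  prependˡ : ∀ {a p q b C D W} → shiftˡ a p q b ∈ moves S →
             Framed ⟨ C ∷ʳ a , q , D ⟩ W → Framed ⟨ C , p , b ∷ D ⟩ W
  prependˡ {a} {p} {q} {b} {C} m∈ (framed C₀ D₀ ⟨ E , _ , F ⟩ core′ X′≡ refl run dl (_ , _ , dr))
    with cong Config.state X′≡ | cong Config.right X′≡ | ∷ʳ≡++⇒ C a C₀ E (cong Config.left X′≡)
  ... | refl | refl | inj₁ (refl , refl) =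
    framed C D₀ ⟨ [] , p , b ∷ F ⟩ (extendˡ [ a ] core′)
      (cong (λ C′ → ⟨ C′ , p , b ∷ F ++ D₀ ⟩) (sym (++-identityʳ C)))
      (frame-inwardˡ C a D₀ core′)
      (s ◅ steps-extendˡ [ a ] run) (_ , _ , ε) (_ , _ , s ◅ steps-extendˡ [ a ] dr)
    where s = fires⇒step m∈ (fireˡ [] F)
  ... | refl | refl | inj₂ (E′ , refl , refl) =
    framed C₀ D₀ ⟨ E′ , p , b ∷ F ⟩ core′ refl refl
      (s ◅ run) (_ , _ , s ◅ proj₂ (proj₂ dl)) (_ , _ , s ◅ dr)
    where s = fires⇒step m∈ (fireˡ E′ F)

  framing : ∀ {X W} → Steps S X W → Framed X W
  framing {⟨ E , p , F ⟩} ε =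
    framed E F ⟨ [] , p , [] ⟩ ⟨ [] , p , [] ⟩ X≡ X≡ ε (_ , _ , ε) (_ , _ , ε)
    where X≡ = cong (λ E′ → ⟨ E′ , p , F ⟩) (sym (++-identityʳ E))
  framing (s ◅ r) with step⇒fires simple s
  ... | _ , m∈ , fireʳ _ _ = prependʳ m∈ (framing r)
  ... | _ , m∈ , fireˡ _ _ = prependˡ m∈ (framing r)

  height : ℕ
  height = max 0 (map (depth ∘ φ) (states S))

  depth≤height : ∀ {q} → q ∈ states S → depth (φ q) ≤ height
  depth≤height q∈ = All.lookup (xs≤max 0 _) (∈-map⁺ (depth ∘ φ) q∈)

  -- ⟦_⟧ is defined on configurations with empty right stack, so F is a path in φ q.
  drained≤height : ∀ {Y q F E q′} → Steps S Y ⟨ [] , q , F ⟩ → Steps S Y ⟨ E , q′ , [] ⟩ → length F ≤ height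
  drained≤height {q = q} {F} dl dr with steps-states dl | steps-states dr
  ... | inj₂ (_ , q∈) | _            = ℕ.≤-trans (at-depth (φ q) F F-path) (depth≤height q∈)
    where F-path = trans (sym (⟦⟧-steps dl)) (⟦⟧-steps dr)
  ... | inj₁ refl     | inj₂ (q∈ , _) = ℕ.≤-trans (at-depth (φ q) F (⟦⟧-steps dr)) (depth≤height q∈)
  ... | inj₁ refl     | inj₁ refl     = z≤n

  core≤height : ∀ {X W} (fr : Framed X W) → size (Framed.core fr) ≤ height
  core≤height (framed _ _ _ _ _ _ _ (_ , _ , dl) (_ , _ , dr)) =
    subst (_≤ height) (sym (steps-size simple dl)) (drained≤height dl dr)

  choices : List (ℕ × ℕ × State × Word × Word)
  choices = cartesianProduct bounds
              (cartesianProduct bounds (cartesianProduct (states S) (cartesianProduct words words)))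
    where
    bounds = upTo (suc height)
    words  = wordsUpTo height

  candidates : Config → List Config
  candidates X = X ∷ map (reframe X) choices

  reachable⇒candidate : ∀ {X W} → Steps S X W → W ∈ candidates X
  reachable⇒candidate ε = here refl
  reachable⇒candidate (s ◅ r) with framing (s ◅ r)
  ... | fr@(framed C₀ D₀ ⟨ E , p , F ⟩ ⟨ E′ , q , F′ ⟩ refl refl run _ _) =
    there (subst (_∈ map (reframe X) choices) (reframe-frame C₀ D₀ E p F E′ q F′)
                 (∈-map⁺ (reframe X) choice∈))
    where
    X = frame C₀ D₀ ⟨ E , p , F ⟩
    core≤ : length E + length F ≤ height
    core≤ = core≤height fr
    core′≤ : length E′ + length F′ ≤ height
    core′≤ = subst (_≤ height) (steps-size simple run) core≤
    choice∈ : (length E , length F , q , E′ , F′) ∈ choices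
    choice∈ = ∈-cartesianProduct⁺ (∈-upTo⁺ (s≤s (ℕ.≤-trans (ℕ.m≤m+n (length E) (length F)) core≤)))
             (∈-cartesianProduct⁺ (∈-upTo⁺ (s≤s (ℕ.≤-trans (ℕ.m≤n+m (length F) (length E)) core≤)))
             (∈-cartesianProduct⁺ (run-target s r)
             (∈-cartesianProduct⁺ (∈-wordsUpTo E′ (ℕ.≤-trans (ℕ.m≤m+n (length E′) (length F′)) core′≤))
                                  (∈-wordsUpTo F′ (ℕ.≤-trans (ℕ.m≤n+m (length F′) (length E′)) core′≤)))))

  uniformlyBounded : UniformlyBounded S
  uniformlyBounded = suc (length choices) , λ X L !L L-reachable →
    ℕ.≤-trans (unique⇒length≤ !L (λ W∈L → reachable⇒candidate (All.lookup L-reachable W∈L)))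
              (ℕ.≤-reflexive (cong suc (length-map (reframe X) choices)))

module Bounded⇒Solvable {S : Machine} (simple : Simple S) (confluent : Confluent S) (n : ℕ)
  (bounded : (X : Config) (L : List Config) → Unique L → All (Steps S X) L → length L ≤ n) where

  open import Data.List.Membership.DecPropositional _≟ᶜ_ using (_∈?_)

  successors : Config → List Config
  successors X = concatMap (λ m → fire m X) (moves S)

  ∈-successors⁺ : ∀ {X Y} → Step S X Y → Y ∈ successors X
  ∈-successors⁺ {X} s with step⇒fires simple s
  ... | _ , m∈ , f = ∈-concatMap⁺ (λ m → fire m X) (lose m∈ (fire-complete f))

  ∈-successors⁻ : ∀ {X Y} → Y ∈ successors X → Step S X Y
  ∈-successors⁻ {X} Y∈ with find (∈-concatMap⁻ (λ m → fire m X) {xs = moves S} Y∈)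
  ... | m , m∈ , Y∈fire = fires⇒step m∈ (fire-sound m X Y∈fire)

  reachableIn : ℕ → Config → List Config
  reachableIn zero    Y = [ Y ]
  reachableIn (suc k) Y = Y ∷ concatMap (reachableIn k) (successors Y)

  ∈-reachableIn⁻ : ∀ k {Y W} → W ∈ reachableIn k Y → Steps S Y W
  ∈-reachableIn⁻ zero    (here refl) = ε
  ∈-reachableIn⁻ (suc k) (here refl) = ε
  ∈-reachableIn⁻ (suc k) {Y} (there W∈) with find (∈-concatMap⁻ (reachableIn k) {xs = successors Y} W∈)
  ... | _ , Y′∈ , W∈′ = ∈-successors⁻ Y′∈ ◅ ∈-reachableIn⁻ k W∈′

  ∈-reachableIn⁺ : ∀ k {Y W} (r : Steps S Y W) → steps r ≤ k → W ∈ reachableIn k Y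
  ∈-reachableIn⁺ zero    ε       _          = here refl
  ∈-reachableIn⁺ (suc k) ε       _          = here refl
  ∈-reachableIn⁺ (suc k) (s ◅ r) (s≤s r≤k) =
    there (∈-concatMap⁺ (reachableIn k) (lose (∈-successors⁺ s) (∈-reachableIn⁺ k r r≤k)))

  -- A loop-free run visits distinct configurations, at most n of them.
  shortRun : ∀ {Y W} → Steps S Y W → ∃ λ (r : Steps S Y W) → steps r ≤ n
  shortRun {Y} r with eraseLoops _≟ᶜ_ r
  ... | r′ , !r′ =
    r′ , ℕ.<⇒≤ (subst (_≤ n) (length-trace r′) (bounded Y (trace r′) !r′ (trace-reachable r′)))

  reachable⇒reachableIn : ∀ {Y W} → Steps S Y W → W ∈ reachableIn n Y
  reachable⇒reachableIn r with shortRun r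
  ... | r′ , r′≤n = ∈-reachableIn⁺ n r′ r′≤n

  infix 4 _≈_
  _≈_ : Config → Config → Set
  Y ≈ Z = ∃ λ W → Steps S Y W × Steps S Z W

  _≈?_ : ∀ Y Z → Dec (Y ≈ Z)
  Y ≈? Z with Any.any? (_∈? reachableIn n Z) (reachableIn n Y)
  ... | yes common with find common
  ...   | W , W∈Y , W∈Z = yes (W , ∈-reachableIn⁻ n W∈Y , ∈-reachableIn⁻ n W∈Z)
  Y ≈? Z | no ¬common =
    no λ (W , rY , rZ) → ¬common (lose (reachable⇒reachableIn rY) (reachable⇒reachableIn rZ))

  ≈-refl : ∀ {Y} → Y ≈ Y
  ≈-refl = _ , ε , ε

  ≈-sym : ∀ {Y Z} → Y ≈ Z → Z ≈ Y
  ≈-sym (W , rY , rZ) = W , rZ , rY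

  ≈-trans : ∀ {Y Z U} → Y ≈ Z → Z ≈ U → Y ≈ U
  ≈-trans {Z = Z} (W₁ , rY , rZ₁) (W₂ , rZ₂ , rU) with confluent Z W₁ W₂ rZ₁ rZ₂
  ... | V , r₁ , r₂ = V , rY ◅◅ r₁ , rU ◅◅ r₂

  ≈-extendˡ : ∀ {Y Z} C → Y ≈ Z → extendˡ C Y ≈ extendˡ C Z
  ≈-extendˡ C (W , rY , rZ) = extendˡ C W , steps-extendˡ C rY , steps-extendˡ C rZ

  ≈-extendʳ : ∀ {Y Z} D → Y ≈ Z → extendʳ D Y ≈ extendʳ D Z
  ≈-extendʳ D (W , rY , rZ) = extendʳ D W , steps-extendʳ D rY , steps-extendʳ D rZ

  ≈-close : ∀ (g : Config → ℕ) → (∀ {X Y} (r : Steps S X Y) → ∣ g X - g Y ∣ ≤ steps r) →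
            ∀ {Y Z} → Y ≈ Z → ∣ g Y - g Z ∣ ≤ n + n
  ≈-close g g-steps {Y} {Z} (W , rY , rZ) with shortRun rY | shortRun rZ
  ... | rY′ , rY′≤n | rZ′ , rZ′≤n = begin
    ∣ g Y - g Z ∣                 ≤⟨ ℕ.∣-∣-triangle (g Y) (g W) (g Z) ⟩
    ∣ g Y - g W ∣ + ∣ g W - g Z ∣ ≡⟨ cong (∣ g Y - g W ∣ +_) (ℕ.∣-∣-comm (g W) (g Z)) ⟩
    ∣ g Y - g W ∣ + ∣ g Z - g W ∣ ≤⟨ ℕ.+-mono-≤ (ℕ.≤-trans (g-steps rY′) rY′≤n)
                                                (ℕ.≤-trans (g-steps rZ′) rZ′≤n) ⟩
    n + n                         ∎
    where open ℕ.≤-Reasoning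

  K : ℕ
  K = suc (n + n)

  grid : (Word → State → Config) → List Config
  grid f = map (uncurry f) (cartesianProduct (wordsUpTo K) (states S))

  ∈-grid⁺ : ∀ f {w q} → length w ≤ K → q ∈ states S → f w q ∈ grid f
  ∈-grid⁺ f {w} w≤K q∈ = ∈-map⁺ (uncurry f) (∈-cartesianProduct⁺ (∈-wordsUpTo w w≤K) q∈)

  ∈-grid⁻ : ∀ f {Z} → Z ∈ grid f → ∃₂ λ w q → q ∈ states S × Z ≡ f w q
  ∈-grid⁻ f Z∈ with ∈-map⁻ (uncurry f) Z∈
  ... | (w , q) , wq∈ , refl = w , q , proj₂ (∈-cartesianProduct⁻ (wordsUpTo K) (states S) wq∈) , refl

  innerRoots leaves : List Config
  innerRoots = grid λ E q → ⟨ E , q , [] ⟩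
  leaves     = grid λ G p → ⟨ [] , p , G ⟩

  Inner : Config → Set
  Inner Y = Any (_≈ Y) innerRoots

  inner? : ∀ Y → Dec (Inner Y)
  inner? Y = Any.any? (_≈? Y) innerRoots

  inner-resp : ∀ {Y Y′} → Y ≈ Y′ → Inner Y → Inner Y′
  inner-resp Y≈Y′ = Any.map (λ Z≈Y → ≈-trans Z≈Y Y≈Y′)

  inner⇒lenʳ≤ : ∀ {Y} → Inner Y → lenʳ Y ≤ n + n
  inner⇒lenʳ≤ i with find i
  ... | _ , Z∈ , Z≈Y with ∈-grid⁻ _ Z∈
  ...   | _ , _ , _ , refl = ≈-close lenʳ (∣lenʳ∣-steps simple) Z≈Y

  inner-extendˡ : ∀ {p G} a → Inner ⟨ [] , p , G ⟩ → Inner ⟨ [ a ] , p , G ⟩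
  inner-extendˡ a i with find i
  ... | _ , Z∈ , Z≈Y with ∈-grid⁻ _ Z∈
  ...   | E , _ , q∈ , refl =
    lose (∈-grid⁺ _ (s≤s (≈-close lenˡ (∣lenˡ∣-steps simple) (≈-sym Z≈Y))) q∈) (≈-extendˡ [ a ] Z≈Y)

  label : List Config → Config → ℕ
  label []       Y = 0
  label (Z ∷ Zs) Y with Z ≈? Y
  ... | yes _ = 0
  ... | no  _ = suc (label Zs Y)

  label-resp : ∀ Zs {Y Y′} → Y ≈ Y′ → label Zs Y ≡ label Zs Y′
  label-resp []       _    = refl
  label-resp (Z ∷ Zs) {Y} {Y′} Y≈Y′ with Z ≈? Y | Z ≈? Y′
  ... | yes _    | yes _     = refl
  ... | no  _    | no  _     = cong suc (label-resp Zs Y≈Y′)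
  ... | yes Z≈Y  | no  Z≉Y′  = ⊥-elim (Z≉Y′ (≈-trans Z≈Y Y≈Y′))
  ... | no  Z≉Y  | yes Z≈Y′  = ⊥-elim (Z≉Y (≈-trans Z≈Y′ (≈-sym Y≈Y′)))

  label-spec : ∀ Zs {Y} → Y ∈ Zs → ∃ λ Z → head (drop (label Zs Y) Zs) ≡ just Z × Z ≈ Y
  label-spec (Z ∷ Zs) {Y} Y∈ with Z ≈? Y | Y∈
  ... | yes Z≈Y | _          = Z , refl , Z≈Y
  ... | no  Z≉Y | here refl  = ⊥-elim (Z≉Y ≈-refl)
  ... | no  _   | there Y∈Zs = label-spec Zs Y∈Zs

  -- The tree of Y branches on the next right-stack symbol while Y is inner, and is
  -- the variable naming the ≈-class of Y otherwise; depth k = 0 is a cut-off never hit below.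
  tree : ℕ → Config → Term
  treeOf : ℕ → (Y : Config) → Dec (Inner Y) → Term
  tree k Y = treeOf k Y (inner? Y)
  treeOf k       Y (no _)  = var (label leaves Y)
  treeOf zero    Y (yes _) = var 0
  treeOf (suc k) Y (yes _) = tree k (extendʳ [ false ] Y) ⇒ tree k (extendʳ [ true ] Y)

  tree-resp : ∀ k {Y Y′} → Y ≈ Y′ → tree k Y ≡ tree k Y′
  treeOf-resp : ∀ k {Y Y′} → Y ≈ Y′ → (d : Dec (Inner Y)) (d′ : Dec (Inner Y′)) →
                treeOf k Y d ≡ treeOf k Y′ d′
  tree-resp k {Y} {Y′} Y≈Y′ = treeOf-resp k Y≈Y′ (inner? Y) (inner? Y′)
  treeOf-resp k       Y≈Y′ (no _)  (no _)   = cong var (label-resp leaves Y≈Y′)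
  treeOf-resp k       Y≈Y′ (yes i) (no ¬i′) = ⊥-elim (¬i′ (inner-resp Y≈Y′ i))
  treeOf-resp k       Y≈Y′ (no ¬i) (yes i′) = ⊥-elim (¬i (inner-resp (≈-sym Y≈Y′) i′))
  treeOf-resp zero    Y≈Y′ (yes _) (yes _)  = refl
  treeOf-resp (suc k) Y≈Y′ (yes _) (yes _)  =
    cong₂ _⇒_ (tree-resp k (≈-extendʳ [ false ] Y≈Y′)) (tree-resp k (≈-extendʳ [ true ] Y≈Y′))

  inner⇒shallow : ∀ {Y} → Inner Y → ¬ (K ≤ lenʳ Y)
  inner⇒shallow i = ℕ.<⇒≱ (s≤s (inner⇒lenʳ≤ i))

  deeper : ∀ k c Y → K ≤ suc k + lenʳ Y → K ≤ k + lenʳ (extendʳ [ c ] Y)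
  deeper k c ⟨ E , p , F ⟩ = subst (K ≤_) (sym (trans (cong (k +_) (length-∷ʳ F c)) (ℕ.+-suc k (length F))))

  tree-stable : ∀ k k′ Y → K ≤ k + lenʳ Y → K ≤ k′ + lenʳ Y → tree k Y ≡ tree k′ Y
  treeOf-stable : ∀ k k′ Y → K ≤ k + lenʳ Y → K ≤ k′ + lenʳ Y → (d : Dec (Inner Y)) →
                  treeOf k Y d ≡ treeOf k′ Y d
  tree-stable k k′ Y h h′ = treeOf-stable k k′ Y h h′ (inner? Y)
  treeOf-stable k       k′       Y h h′ (no _)  = refl
  treeOf-stable zero    k′       Y h h′ (yes i) = ⊥-elim (inner⇒shallow i h)
  treeOf-stable (suc k) zero     Y h h′ (yes i) = ⊥-elim (inner⇒shallow i h′)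
  treeOf-stable (suc k) (suc k′) Y h h′ (yes i) = cong₂ _⇒_ (stable false) (stable true)
    where
    stable : ∀ c → tree k (extendʳ [ c ] Y) ≡ tree k′ (extendʳ [ c ] Y)
    stable c = tree-stable k k′ (extendʳ [ c ] Y) (deeper k c Y h) (deeper k′ c Y h′)

  tree-unfold : ∀ k {Y} → Inner Y →
                tree (suc k) Y ≡ tree k (extendʳ [ false ] Y) ⇒ tree k (extendʳ [ true ] Y)
  tree-unfold k {Y} i = unfold (inner? Y)
    where
    unfold : (d : Dec (Inner Y)) →
             treeOf (suc k) Y d ≡ tree k (extendʳ [ false ] Y) ⇒ tree k (extendʳ [ true ] Y)
    unfold (yes _) = refl
    unfold (no ¬i) = ⊥-elim (¬i i)

  -- ψ a sends the variable of the class of a leaf Z to the tree of a·Z.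
  ψ : Bool → Subst
  ψ a v = maybe′ (λ Z → tree K (extendˡ [ a ] Z)) (var 0) (head (drop v leaves))

  ψ-tree : ∀ a k {p G} → p ∈ states S → length G ≤ K → K ≤ k + length G →
           applySubst (ψ a) (tree k ⟨ [] , p , G ⟩) ≡ tree k ⟨ [ a ] , p , G ⟩
  ψ-treeOf : ∀ a k {p G} → p ∈ states S → length G ≤ K → K ≤ k + length G →
             (d : Dec (Inner ⟨ [] , p , G ⟩)) →
             applySubst (ψ a) (treeOf k ⟨ [] , p , G ⟩ d) ≡ tree k ⟨ [ a ] , p , G ⟩
  ψ-tree a k p∈ G≤K h = ψ-treeOf a k p∈ G≤K h (inner? _)
  ψ-treeOf a k {p} {G} p∈ G≤K h (no _) with label-spec leaves (∈-grid⁺ (λ G p → ⟨ [] , p , G ⟩) G≤K p∈)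
  ... | Z , leaf≡Z , Z≈Y = begin
    maybe′ (λ Z → tree K (extendˡ [ a ] Z)) (var 0) (head (drop (label leaves ⟨ [] , p , G ⟩) leaves))
                               ≡⟨ cong (maybe′ (λ Z → tree K (extendˡ [ a ] Z)) (var 0)) leaf≡Z ⟩
    tree K (extendˡ [ a ] Z)   ≡⟨ tree-resp K (≈-extendˡ [ a ] Z≈Y) ⟩
    tree K ⟨ [ a ] , p , G ⟩   ≡⟨ tree-stable K k ⟨ [ a ] , p , G ⟩ (ℕ.m≤m+n K (length G)) h ⟩
    tree k ⟨ [ a ] , p , G ⟩   ∎
    where open ≡-Reasoning
  ψ-treeOf a zero    p∈ G≤K h (yes i) = ⊥-elim (inner⇒shallow i h)
  ψ-treeOf a (suc k) {p} {G} p∈ G≤K h (yes i) =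
    trans (cong₂ _⇒_ (child false) (child true)) (sym (tree-unfold k (inner-extendˡ a i)))
    where
    child : ∀ c → applySubst (ψ a) (tree k ⟨ [] , p , G ∷ʳ c ⟩) ≡ tree k ⟨ [ a ] , p , G ∷ʳ c ⟩
    child c = ψ-tree a k p∈ (subst (_≤ K) (sym (length-∷ʳ G c)) (s≤s (inner⇒lenʳ≤ i)))
                            (deeper k c ⟨ [] , p , G ⟩ h)

  φ : Subst
  φ p = tree K ⟨ [] , p , [] ⟩

  φ-unfold : ∀ {β} → β ∈ states S →
             φ β ≡ tree (n + n) ⟨ [] , β , [ false ] ⟩ ⇒ tree (n + n) ⟨ [] , β , [ true ] ⟩
  φ-unfold β∈ = tree-unfold (n + n) (lose (∈-grid⁺ (λ E q → ⟨ E , q , [] ⟩) z≤n β∈) ≈-refl)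

  select-ψ : ∀ a → selectψ (ψ false) (ψ true) a ≡ ψ a
  select-ψ false = refl
  select-ψ true  = refl

  ψφ≡subtree : ∀ {a α β b} → α ∈ states S → ⟨ [ a ] , α , [] ⟩ ≈ ⟨ [] , β , [ b ] ⟩ →
               applySubst (selectψ (ψ false) (ψ true) a) (φ α) ≡ tree (n + n) ⟨ [] , β , [ b ] ⟩
  ψφ≡subtree {a} {α} {β} {b} α∈ e = begin
    applySubst (selectψ (ψ false) (ψ true) a) (φ α) ≡⟨ cong (λ σ → applySubst σ (φ α)) (select-ψ a) ⟩
    applySubst (ψ a) (tree K ⟨ [] , α , [] ⟩)        ≡⟨ ψ-tree a K α∈ z≤n (ℕ.m≤m+n K 0) ⟩
    tree K ⟨ [ a ] , α , [] ⟩                        ≡⟨ tree-resp K e ⟩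
    tree K ⟨ [] , β , [ b ] ⟩                        ≡⟨ tree-stable K (n + n) _ (ℕ.m≤m+n K 1)
                                                          (ℕ.≤-reflexive (ℕ.+-comm 1 (n + n))) ⟩
    tree (n + n) ⟨ [] , β , [ b ] ⟩                  ∎
    where open ≡-Reasoning

  ⊨-joinable : ∀ {a α β b} → α ∈ states S → β ∈ states S → ⟨ [ a ] , α , [] ⟩ ≈ ⟨ [] , β , [ b ] ⟩ →
               Models φ (ψ false) (ψ true) ⟨ a , α ,ε⟩≐⟨ε, β , b ⟩
  ⊨-joinable {β = β} {false} α∈ β∈ e =
    right , trans (cong (_⇒ right) (ψφ≡subtree α∈ e)) (sym (φ-unfold β∈))
    where right = tree (n + n) ⟨ [] , β , [ true ] ⟩
  ⊨-joinable {β = β} {true}  α∈ β∈ e =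
    left , trans (cong (left ⇒_) (ψφ≡subtree α∈ e)) (sym (φ-unfold β∈))
    where left = tree (n + n) ⟨ [] , β , [ false ] ⟩

  ⊨-move : ∀ {m} → m ∈ moves S → Models φ (ψ false) (ψ true) (constraint m)
  ⊨-move {shiftʳ a p q b} m∈ = ⊨-joinable (proj₁ (step-states s)) (proj₂ (step-states s)) (_ , s ◅ ε , ε)
    where s = fires⇒step m∈ (fireʳ [] [])
  ⊨-move {shiftˡ a p q b} m∈ = ⊨-joinable (proj₂ (step-states s)) (proj₁ (step-states s)) (_ , ε , s ◅ ε)
    where s = fires⇒step m∈ (fireˡ [] [])

  solvable : SSUSolvable (reduction S)
  solvable = φ , ψ false , ψ true , map⁺ (All.tabulate ⊨-move)

lemma5p13 : Σ (Machine → List Constraint) λ f →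
    (S : Machine) → Confluent S → Simple S →
      (UniformlyBounded S → SSUSolvable (f S)) × (SSUSolvable (f S) → UniformlyBounded S)
lemma5p13 = reduction , λ S confluent simple →
  (λ (n , bounded) → Bounded⇒Solvable.solvable simple confluent n bounded) ,
  (λ (φ , ψ₀ , ψ₁ , ⊨S) → Solvable⇒Bounded.uniformlyBounded simple ⊨S)
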